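{- Let $\mathcal{S}=(\mathscr{X},\nabla_{\mathcal{S}})$ and $\mathcal{T}=(\mathscr{Y},\nabla_{\mathcal{T}})$ be non-commutative spacetimes and let $f:\mathscr{X}\to\mathscr{Y}$ be a geometric map $f:\mathcal{S}\to\mathcal{T}$ which has a left adjoint $f_!:\mathscr{Y}\to\mathscr{X}$ (i.e. $f_!(y)\leq x$ iff $y\leq f(x)$). Then $f$ is logical iff for all $a\in\mathscr{Y}$ and $b\in\mathscr{X}$, \[ f_!\big(f(b)\otimes\nabla_{\mathcal{T}}a\big)=b\otimes\nabla_{\mathcal{S}}f_!(a). \]
   Context: A monoidal poset is a poset with a monoid structure $(\otimes,e)$ whose multiplication is order preserving in each argument. A quantale is a monoidal poset with all joins whose multiplication distributes over arbitrary joins on both sides. A map $g$ between monoidal posets is oplax monoidal if it is order preserving, $g(e)\leq e$ and $g(a\otimes b)\leq g(a)\otimes g(b)$; it is strict monoidal if $g(e)=e$ and $g(a\otimes b)=g(a)\otimes g(b)$. A non-commutative spacetime is a pair $(\mathscr{X},\nabla)$ with $\mathscr{X}$ a quantale and $\nabla:\mathscr{X}\to\mathscr{X}$ oplax monoidal and join preserving. Its implication $\to_{\mathcal{S}}$ is the (unique) binary operation with $a\otimes\nabla b\leq c$ iff $b\leq a\to_{\mathcal{S}}c$ for all $a,b,c$. A geometric map $f:\mathcal{S}\to\mathcal{T}$ between non-commutative spacetimes is a join preserving strict monoidal map $f:\mathscr{X}\to\mathscr{Y}$ with $f\circ\nabla_{\mathcal{S}}=\nabla_{\mathcal{T}}\circ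 f$; it is logical if moreover $f(a\to_{\mathcal{S}}b)=f(a)\to_{\mathcal{T}}f(b)$ for all $a,b\in\mathscr{X}$. -}

module Defs where

open import Level using (Level; suc; _⊔_)
open import Data.Product using (Σ; _×_; _,_; ∃)
open import Relation.Binary.PropositionalEquality using (_≡_)
open import Relation.Binary.Structures using (IsPartialOrder)
open import Function using (_⇔_)

record Quantale (c ℓ : Level) : Set (suc (c ⊔ ℓ)) where
  infixr 7 _⊗_
  infix 4 _≤_
  field
    Carrier : Set c
    _≤_ : Carrier → Carrier → Set ℓ
    isPartialOrder : IsPartialOrder _≡_ _≤_
    _⊗_ : Carrier → Carrier → Carrier
    e : Carrier
    ⊗-assoc : ∀ x y z → (x ⊗ y) ⊗ z ≡ x ⊗ (y ⊗ z)
    ⊗-identityˡ : ∀ x → e ⊗ x ≡ x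
    ⊗-identityʳ : ∀ x → x ⊗ e ≡ x
    ⊗-mono : ∀ {a a′ b b′} → a ≤ a′ → b ≤ b′ → a ⊗ b ≤ a′ ⊗ b′
    ⋁ : (Carrier → Set c) → Carrier
    ⋁-upper : ∀ (P : Carrier → Set c) x → P x → x ≤ ⋁ P
    ⋁-least : ∀ (P : Carrier → Set c) u → (∀ x → P x → x ≤ u) → ⋁ P ≤ u
    ⊗-distribˡ-⋁ : ∀ a (P : Carrier → Set c) →
      a ⊗ ⋁ P ≡ ⋁ (λ z → Σ Carrier λ x → P x × (z ≡ a ⊗ x))
    ⊗-distribʳ-⋁ : ∀ a (P : Carrier → Set c) →
      ⋁ P ⊗ a ≡ ⋁ (λ z → Σ Carrier λ x → P x × (z ≡ x ⊗ a))

  Image : (Carrier → Carrier) → (Carrier → Set c) → Carrier → Set c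
  Image g P z = Σ Carrier λ x → P x × (z ≡ g x)

module _ {c ℓ c′ ℓ′} (X : Quantale c ℓ) (Y : Quantale c′ ℓ′) where
  private
    module X = Quantale X
    module Y = Quantale Y

  -- g preserves the join of every subset P: g(⋁P) is the least upper bound
  -- in Y of the image {g x | x ∈ P} (stated via the lub property, which
  -- avoids universe-level issues when c ≠ c′).
  JoinPreserving : (X.Carrier → Y.Carrier) → Set (suc c ⊔ c′ ⊔ ℓ′)
  JoinPreserving g = ∀ (P : X.Carrier → Set c) →
    (∀ x → P x → g x Y.≤ g (X.⋁ P)) ×
    (∀ u → (∀ x → P x → g x Y.≤ u) → g (X.⋁ P) Y.≤ u)

  OplaxMonoidal : (X.Carrier → Y.Carrier) → Set (c ⊔ ℓ ⊔ ℓ′)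
  OplaxMonoidal g =
    (∀ {a b} → a X.≤ b → g a Y.≤ g b) ×
    (g X.e Y.≤ Y.e) ×
    (∀ a b → g (a X.⊗ b) Y.≤ g a Y.⊗ g b)

  StrictMonoidal : (X.Carrier → Y.Carrier) → Set (c ⊔ c′)
  StrictMonoidal g = (g X.e ≡ Y.e) × (∀ a b → g (a X.⊗ b) ≡ g a Y.⊗ g b)

  LeftAdjoint : (Y.Carrier → X.Carrier) → (X.Carrier → Y.Carrier) → Set (c ⊔ ℓ ⊔ c′ ⊔ ℓ′)
  LeftAdjoint h g = ∀ y x → (h y X.≤ x) ⇔ (y Y.≤ g x)

-- The implication →S is the unique operation with
-- a ⊗ ∇ b ≤ c  iff  b ≤ a →S c; it always exists in a quantale, and we carry
-- it as data together with its defining property (which determines it).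
record Spacetime (c ℓ : Level) : Set (suc (c ⊔ ℓ)) where
  field
    X : Quantale c ℓ
  open Quantale X public
  field
    ∇ : Carrier → Carrier
    ∇-oplax : OplaxMonoidal X X ∇
    ∇-join : JoinPreserving X X ∇
    _⇒_ : Carrier → Carrier → Carrier
    ⇒-adj : ∀ a b c → (a ⊗ ∇ b ≤ c) ⇔ (b ≤ a ⇒ c)

module _ {c ℓ c′ ℓ′} (S : Spacetime c ℓ) (T : Spacetime c′ ℓ′) where
  private
    module S = Spacetime S
    module T = Spacetime T

  IsGeometric : (S.Carrier → T.Carrier) → Set (suc c ⊔ c′ ⊔ ℓ′)
  IsGeometric f = JoinPreserving S.X T.X f × StrictMonoidal S.X T.X f ×
                  (∀ a → f (S.∇ a) ≡ T.∇ (f a))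

  IsLogical : (S.Carrier → T.Carrier) → Set (suc c ⊔ c′ ⊔ ℓ′)
  IsLogical f = IsGeometric f × (∀ a b → f (a S.⇒ b) ≡ (f a T.⇒ f b))

-- Both sides of the
-- theorem are equations, and each is turned into a statement about the
-- elements below or above it (indirect equality in a partial order).  Two
-- chains of Galois connections, using only f! ⊣ f and the residuations
-- a ⊗ ∇ b ≤ c ⇔ b ≤ a ⇒ c of S and T, give for all a ∈ T and b, c ∈ S
--
--   a ≤ f (b ⇒ c)     ⇔  b ⊗ ∇ (f! a) ≤ c,
--   a ≤ f b ⇒ f c     ⇔  f! (f b ⊗ ∇ a) ≤ c.
--
-- Hence f (b ⇒ c) = f b ⇒ f c for all b, c (same lower bounds a) iff
-- f! (f b ⊗ ∇ a) = b ⊗ ∇ (f! a) for all a, b (same upper bounds c).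
module Submission where

open import Defs
open import Level using (_⊔_)
open import Relation.Binary.Core using (Rel)
open import Relation.Binary.PropositionalEquality using (_≡_; refl)
open import Relation.Binary.Structures using (IsPartialOrder)
open import Function using (_⇔_)
open import Function.Bundles using (mk⇔; Equivalence)
open import Function.Construct.Identity using (⇔-id)
open import Function.Construct.Symmetry using (⇔-sym)
open import Function.Construct.Composition using () renaming (equivalence to ⇔-trans)
open import Data.Product using (_,_; proj₂)

open Equivalence using (to; from)

module IndirectEquality {a ℓ} {A : Set a} {_≤_ : Rel A ℓ}
                        (po : IsPartialOrder _≡_ _≤_) where
  open IsPartialOrder po using (antisym) renaming (refl to ≤-refl)

  same-lower-bounds : ∀ {x y} → (x ≡ y) ⇔ (∀ z → z ≤ x ⇔ z ≤ y)
  same-lower-bounds {x} {y} = mk⇔ (λ { refl z → ⇔-id _ })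
    (λ below → antisym (to (below x) ≤-refl) (from (below y) ≤-refl))

  same-upper-bounds : ∀ {x y} → (x ≡ y) ⇔ (∀ z → x ≤ z ⇔ y ≤ z)
  same-upper-bounds {x} {y} = mk⇔ (λ { refl z → ⇔-id _ })
    (λ above → antisym (from (above y) ≤-refl) (to (above x) ≤-refl))

module Transposition {c ℓ c′ ℓ′} (S : Spacetime c ℓ) (T : Spacetime c′ ℓ′)
    (f : Spacetime.Carrier S → Spacetime.Carrier T)
    (f! : Spacetime.Carrier T → Spacetime.Carrier S)
    (adj : LeftAdjoint (Spacetime.X S) (Spacetime.X T) f! f) where
  private
    module S = Spacetime S
    module T = Spacetime T

  -- a ≤ f (b ⇒ c)  ⇔  f! a ≤ b ⇒ c  ⇔  b ⊗ ∇ (f! a) ≤ c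
  below-image-of-⇒ : ∀ a b c → (a T.≤ f (b S.⇒ c)) ⇔ (b S.⊗ S.∇ (f! a) S.≤ c)
  below-image-of-⇒ a b c =
    ⇔-trans (⇔-sym (adj a (b S.⇒ c))) (⇔-sym (S.⇒-adj b (f! a) c))

  -- a ≤ f b ⇒ f c  ⇔  f b ⊗ ∇ a ≤ f c  ⇔  f! (f b ⊗ ∇ a) ≤ c
  below-⇒-of-images : ∀ a b c → (a T.≤ f b T.⇒ f c) ⇔ (f! (f b T.⊗ T.∇ a) S.≤ c)
  below-⇒-of-images a b c =
    ⇔-trans (⇔-sym (T.⇒-adj (f b) a (f c))) (⇔-sym (adj (f b T.⊗ T.∇ a) c))

theorem5p12 : ∀ {c ℓ c′ ℓ′} (S : Spacetime c ℓ) (T : Spacetime c′ ℓ′)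
    (f : Spacetime.Carrier S → Spacetime.Carrier T)
    (f! : Spacetime.Carrier T → Spacetime.Carrier S) →
    IsGeometric S T f →
    LeftAdjoint (Spacetime.X S) (Spacetime.X T) f! f →
    IsLogical S T f ⇔
    (∀ (a : Spacetime.Carrier T) (b : Spacetime.Carrier S) →
    f! (Spacetime._⊗_ T (f b) (Spacetime.∇ T a))
    ≡ Spacetime._⊗_ S b (Spacetime.∇ S (f! a)))
theorem5p12 {c} {_} {c′} S T f f! geometric adj =
  mk⇔ (λ logical → commutation (proj₂ logical))
      (λ commutes → geometric , preservation commutes)
  where
  module S = Spacetime S
  module T = Spacetime T
  open Transposition S T f f! adj
  module ≤S = IndirectEquality S.isPartialOrder
  module ≤T = IndirectEquality T.isPartialOrder

  -- The two sides of the theorem; geometricity of f only serves as the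
  -- first component of IsLogical.
  Preserves⇒ Commutes : Set (c ⊔ c′)
  Preserves⇒ = ∀ b c → f (b S.⇒ c) ≡ (f b T.⇒ f c)
  Commutes = ∀ a b → f! (f b T.⊗ T.∇ a) ≡ b S.⊗ S.∇ (f! a)

  -- Preservation of ⇒ implies the commutation law: both sides have the same
  -- upper bounds c, compared through the lower bound a of the implications.
  commutation : Preserves⇒ → Commutes
  commutation preserves a b = from ≤S.same-upper-bounds λ c →
    ⇔-trans (⇔-sym (below-⇒-of-images a b c))
      (⇔-trans (⇔-sym (to ≤T.same-lower-bounds (preserves b c) a))
               (below-image-of-⇒ a b c))

  -- Conversely the commutation law gives preservation of ⇒: both
  -- implications have the same lower bounds a, compared through the upper
  -- bound c.
  preservation : Commutes → Preserves⇒
  preservation commutes b c = from ≤T.same-lower-bounds λ a →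
    ⇔-trans (below-image-of-⇒ a b c)
      (⇔-trans (⇔-sym (to ≤S.same-upper-bounds (commutes a b) c))
               (⇔-sym (below-⇒-of-images a b c)))
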